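{- Let $P=(X,\prec)$ be a finite poset. Then for every integer $t\ge 2$, $$\Omega_q(P,t)^2\ \geqslant_q\ \Omega_q(P,t+1)\cdot\Omega_q(P,t-1),$$ where the inequality holds coefficient-wise as polynomials in $q$.
   Context: With $n=|X|$, $\Omega_q(P,t):=\sum_g q^{|g|-n}$, where the sum is over all maps $g:X\to[t]$ with $g(x)\le g(y)$ whenever $x\prec y$, and $|g|:=\sum_{x\in X}g(x)$. -}

module Defs where

open import Data.Nat using (ℕ; zero; suc; _+_; _*_; _∸_; _≤_)
open import Data.Nat.Properties using (_≟_)
open import Data.Fin using (Fin; toℕ; _≤?_) renaming (_≤_ to _≤F_)
open import Data.Fin.Properties using (all?)
open import Data.List using (List; []; _∷_; concatMap; map; length; filter; upTo; allFin)
open import Data.Nat.ListAction using (sum)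
open import Data.Product using (_×_; _,_)
open import Relation.Nullary using (Dec; yes; no; _→-dec_)
open import Relation.Nullary.Decidable using (_×-dec_)
open import Relation.Binary using (Rel; Decidable; IsStrictPartialOrder)
open import Relation.Binary.PropositionalEquality using (_≡_)
open import Level using (0ℓ)

record FinPoset (n : ℕ) : Set₁ where
  field
    _≺_ : Rel (Fin n) 0ℓ
    isStrictPartialOrder : IsStrictPartialOrder _≡_ _≺_
    _≺?_ : Decidable _≺_

-- All maps Fin n → Fin t (Fin t ≅ [t] via i ↦ toℕ i + 1).
allMaps : (n t : ℕ) → List (Fin n → Fin t)
allMaps zero t = (λ ()) ∷ []
allMaps (suc n) t =
  concatMap (λ g → map (λ i → λ { Fin.zero → i ; (Fin.suc x) → g x }) (allFin t))
            (allMaps n t)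

OrderPreserving : ∀ {n t} (P : FinPoset n) → (Fin n → Fin t) → Set
OrderPreserving P g = ∀ x y → x ≺ y → g x ≤F g y
  where open FinPoset P

orderPreserving? : ∀ {n t} (P : FinPoset n) (g : Fin n → Fin t) → Dec (OrderPreserving P g)
orderPreserving? P g = all? λ x → all? λ y → (x ≺? y) →-dec (g x ≤? g y)
  where open FinPoset P

-- |g| - n  =  Σ_x (g(x) - 1)  =  Σ_x toℕ (g x)
weight : ∀ {n t} → (Fin n → Fin t) → ℕ
weight {n} g = sum (map (λ x → toℕ (g x)) (allFin n))

-- Polynomials in q with ℕ coefficients, represented by coefficient functions.
Poly : Set
Poly = ℕ → ℕ

Ω : ∀ {n} → FinPoset n → ℕ → Poly
Ω {n} P t k = length (filter (λ g → orderPreserving? P g ×-dec (weight g ≟ k)) (allMaps n t))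

_·_ : Poly → Poly → Poly
(f · g) k = sum (map (λ i → f i * g (k ∸ i)) (upTo (suc k)))

_≥q_ : Poly → Poly → Set
f ≥q g = ∀ k → g k ≤ f k

module Submission where

-- Write t for the middle value. A pair (f, g) of order-preserving maps into [t+1] and [t-1] is
-- recorded as the monotone functions U = f - 1 ∈ [0, t] and V = g ∈ [1, t-1]. Exchanging the
-- values of U and V on a set S keeps both monotone as soon as S is closed under the crossings of
-- U and V (x ≺ y with U y < V x or V y < U x). Taking S to be the least such set containing the
-- points where U reaches t, one has V < U on S, so the exchanged pair (A, B) satisfies A ≤ t - 1
-- and 1 ≤ B ≤ t, so (A + 1, B) is a pair of order-preserving maps into [t], and pointwise sums,
-- hence total weights, are unchanged. The exchange does not change the crossings, hence
-- neither S, so it is an involution and (f, g) ↦ (A + 1, B) is injective.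

open import Defs
open import Data.Nat using (ℕ; zero; suc; _+_; _*_; _∸_; _≤_; _<_; z≤n; s≤s; s≤s⁻¹; NonZero)
open import Data.Nat.Properties
open import Data.Nat.DivMod using (_mod_; m%n<n; m<n⇒m%n≡m)
open import Data.Nat.ListAction using (sum)
open import Data.Fin using (Fin; toℕ)
open import Data.Fin.Properties using (all?; toℕ-injective; toℕ≤pred[n]; toℕ<n; toℕ-fromℕ<)
open import Data.Fin.Subset using (Subset) renaming (_∈_ to _∈ₛ_)
open import Data.Fin.Subset.Properties using (_∈?_; anySubset?)
open import Data.Vec using (tabulate)
open import Data.Vec.Properties using (lookup∘tabulate; lookup⇒[]=; []=⇒lookup)
open import Data.List using (List; []; _∷_; _++_; concatMap; map; length; filter; upTo; allFin; cartesianProduct)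
open import Data.List.Properties using (length-++; length-map; map-cong)
open import Data.List.Membership.Propositional using (_∈_; find)
open import Data.List.Membership.Propositional.Properties
open import Data.List.Relation.Unary.Any as Any using (here; there)
open import Data.List.Relation.Unary.All as All using (All)
import Data.List.Relation.Unary.All.Properties as All
open import Data.List.Relation.Unary.AllPairs as AllPairs using (AllPairs; []; _∷_)
import Data.List.Relation.Unary.AllPairs.Properties as AllPairs
open import Data.List.Relation.Unary.Unique.Setoid using (Unique)
import Data.List.Relation.Unary.Unique.Setoid.Properties as Unique
open import Data.Product using (∃-syntax; _×_; _,_; proj₁; proj₂)
open import Data.Product.Relation.Binary.Pointwise.NonDependent using (Pointwise; _×ₛ_)
open import Data.Sum using (_⊎_; inj₁; inj₂)
open import Data.Bool using (if_then_else_)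
open import Function using (_∘_)
open import Level using (0ℓ)
open import Relation.Nullary using (¬_; Dec; contradiction)
open import Relation.Nullary.Decidable
  using (yes; no; does; map′; ¬?; _×-dec_; _⊎-dec_; _→-dec_; decidable-stable; dec-true)
open import Relation.Unary using (Pred)
open import Relation.Binary using (Setoid; Rel)
open import Relation.Binary.PropositionalEquality

length-≤-injection : {B : Set} (S : Setoid 0ℓ 0ℓ) (Rep : B → Setoid.Carrier S → Set)
  (xs : List (Setoid.Carrier S)) (ys : List B) → Unique S xs →
  (∀ {x} → x ∈ xs → ∃[ y ] y ∈ ys × Rep y x) →
  (∀ {x x' y} → x ∈ xs → x' ∈ xs → Rep y x → Rep y x' → Setoid._≈_ S x x') →
  length xs ≤ length ys
length-≤-injection S Rep [] ys _ _ _ = z≤n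
length-≤-injection S Rep (x ∷ xs) ys (x≉xs ∷ distinct) cover injective
  with cover (here refl)
... | y , y∈ys , y~x with ∈-∃++ y∈ys
... | pre , post , refl = begin
  suc (length xs)                ≤⟨ s≤s (length-≤-injection S Rep xs (pre ++ post) distinct cover′ injective′) ⟩
  suc (length (pre ++ post))     ≡⟨ cong suc (length-++ pre) ⟩
  suc (length pre + length post) ≡⟨ +-suc (length pre) (length post) ⟨
  length pre + length (y ∷ post) ≡⟨ length-++ pre ⟨
  length (pre ++ y ∷ post)       ∎
  where
  open ≤-Reasoning
  injective′ : ∀ {x x' y} → x ∈ xs → x' ∈ xs → Rep y x → Rep y x' → Setoid._≈_ S x x'
  injective′ x∈xs x'∈xs = injective (there x∈xs) (there x'∈xs)
  cover′ : ∀ {x'} → x' ∈ xs → ∃[ y' ] y' ∈ pre ++ post × Rep y' x'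
  cover′ {x'} x'∈xs with cover (there x'∈xs)
  ... | y' , y'∈ys , y'~x' with ∈-++⁻ pre y'∈ys
  ... | inj₁ y'∈pre          = y' , ∈-++⁺ˡ y'∈pre , y'~x'
  ... | inj₂ (there y'∈post) = y' , ∈-++⁺ʳ pre y'∈post , y'~x'
  ... | inj₂ (here refl)     = contradiction (injective (here refl) (there x'∈xs) y~x y'~x') (All.lookup x≉xs x'∈xs)

length-concatMap : {A B : Set} (f : A → List B) (xs : List A) →
  length (concatMap f xs) ≡ sum (map (length ∘ f) xs)
length-concatMap f []       = refl
length-concatMap f (x ∷ xs) = trans (length-++ (f x)) (cong (length (f x) +_) (length-concatMap f xs))

length-cartesianProduct : {A B : Set} (xs : List A) (ys : List B) →
  length (cartesianProduct xs ys) ≡ length xs * length ys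
length-cartesianProduct []       ys = refl
length-cartesianProduct (x ∷ xs) ys =
  trans (length-++ (map (x ,_) ys)) (cong₂ _+_ (length-map (x ,_) ys) (length-cartesianProduct xs ys))

sum-map-+ : {A : Set} (F G : A → ℕ) (xs : List A) →
  sum (map F xs) + sum (map G xs) ≡ sum (map (λ x → F x + G x) xs)
sum-map-+ F G []       = refl
sum-map-+ F G (x ∷ xs) =
  trans (+-interchange (F x) (sum (map F xs)) (G x) (sum (map G xs))) (cong (F x + G x +_) (sum-map-+ F G xs))
  where open import Algebra.Properties.CommutativeSemigroup +-commutativeSemigroup renaming (interchange to +-interchange)

toℕ-mod : ∀ {a t} .{{_ : NonZero t}} → a < t → toℕ (a mod t) ≡ a
toℕ-mod {a} {t} a<t = trans (toℕ-fromℕ< (m%n<n a t)) (m<n⇒m%n≡m a<t)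

-- allMaps extends maps by a pattern lambda, which cannot be named here; these lemmas are stated
-- for any extension operator with its two defining equations.
module _ {n t : ℕ} (extend : (Fin n → Fin t) → Fin t → Fin (suc n) → Fin t)
         (extend-zero : ∀ g i → extend g i Fin.zero ≡ i)
         (extend-suc : ∀ g i x → extend g i (Fin.suc x) ≡ g x) where

  extensions : List (Fin n → Fin t) → List (Fin (suc n) → Fin t)
  extensions = concatMap (λ g → map (extend g) (allFin t))

  extensions-complete : ∀ {gs} (g : Fin (suc n) → Fin t) →
    (∃[ h ] h ∈ gs × h ≗ g ∘ Fin.suc) → ∃[ h ] h ∈ extensions gs × h ≗ g
  extensions-complete g (h , h∈gs , h≗g) =
    extend h (g Fin.zero) ,
    ∈-concatMap⁺ (λ g → map (extend g) (allFin t))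
      (Any.map (λ { refl → ∈-map⁺ (extend h) (∈-allFin (g Fin.zero)) }) h∈gs) ,
    agree
    where
    agree : extend h (g Fin.zero) ≗ g
    agree Fin.zero    = extend-zero h (g Fin.zero)
    agree (Fin.suc x) = trans (extend-suc h (g Fin.zero) x) (h≗g x)

  extensions-distinct : ∀ {gs} → Unique (Fin n →-setoid Fin t) gs →
    Unique (Fin (suc n) →-setoid Fin t) (extensions gs)
  extensions-distinct {gs} distinct =
    AllPairs.concat⁺ (All.map⁺ (All.universal same-prefix gs))
                     (AllPairs.map⁺ (AllPairs.map different-prefix distinct))
    where
    same-prefix : ∀ g → Unique (Fin (suc n) →-setoid Fin t) (map (extend g) (allFin t))
    same-prefix g = AllPairs.map⁺ (AllPairs.tabulate⁺ λ i≢j e →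
      i≢j (trans (sym (extend-zero g _)) (trans (e Fin.zero) (extend-zero g _))))
    different-prefix : ∀ {g h} → ¬ g ≗ h →
      All (λ e → All (λ e' → ¬ e ≗ e') (map (extend h) (allFin t))) (map (extend g) (allFin t))
    different-prefix g≉h = All.map⁺ (All.universal (λ i → All.map⁺ (All.universal (λ j e →
      g≉h (λ x → trans (sym (extend-suc _ i x)) (trans (e (Fin.suc x)) (extend-suc _ j x)))) _)) _)

allMaps-complete : ∀ n t (g : Fin n → Fin t) → ∃[ h ] h ∈ allMaps n t × h ≗ g
allMaps-complete zero    t g = _ , here refl , λ ()
allMaps-complete (suc n) t g =
  extensions-complete _ (λ _ _ → refl) (λ _ _ _ → refl) g (allMaps-complete n t (g ∘ Fin.suc))

allMaps-distinct : ∀ n t → Unique (Fin n →-setoid Fin t) (allMaps n t)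
allMaps-distinct zero    t = All.[] ∷ []
allMaps-distinct (suc n) t =
  extensions-distinct _ (λ _ _ → refl) (λ _ _ _ → refl) (allMaps-distinct n t)

weight-+-cong : ∀ {n s r s' r'} {f : Fin n → Fin s} {g : Fin n → Fin r} {f' : Fin n → Fin s'} {g' : Fin n → Fin r'} →
  (∀ x → toℕ (f x) + toℕ (g x) ≡ toℕ (f' x) + toℕ (g' x)) → weight f + weight g ≡ weight f' + weight g'
weight-+-cong {n} same-sums = trans (sum-map-+ _ _ (allFin n))
  (trans (cong sum (map-cong same-sums (allFin n))) (sym (sum-map-+ _ _ (allFin n))))

_≗²_ : {A B C : Set} → (A → B) × (A → C) → (A → B) × (A → C) → Set
_≗²_ = Pointwise _≗_ _≗_

module _ {n : ℕ} (P : FinPoset n) where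

  orderPreserving-resp : ∀ {t} {g h : Fin n → Fin t} → g ≗ h → OrderPreserving P g → OrderPreserving P h
  orderPreserving-resp g≗h g↑ x y x≺y = subst₂ (λ a b → toℕ a ≤ toℕ b) (g≗h x) (g≗h y) (g↑ x y x≺y)

  weight-resp : ∀ {t} {g h : Fin n → Fin t} → g ≗ h → weight g ≡ weight h
  weight-resp g≗h = cong sum (map-cong (cong toℕ ∘ g≗h) (allFin n))

  isOrderMapOfWeight? : ∀ {t} k (g : Fin n → Fin t) → Dec (OrderPreserving P g × weight g ≡ k)
  isOrderMapOfWeight? k g = orderPreserving? P g ×-dec (weight g ≟ k)

  orderMaps : (t k : ℕ) → List (Fin n → Fin t)
  orderMaps t k = filter (isOrderMapOfWeight? k) (allMaps n t)

  orderMaps-complete : ∀ {t} (g : Fin n → Fin t) → OrderPreserving P g →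
    ∃[ h ] h ∈ orderMaps t (weight g) × h ≗ g
  orderMaps-complete {t} g g↑ with allMaps-complete n t g
  ... | h , h∈ , h≗g = h , ∈-filter⁺ _ h∈ (orderPreserving-resp (sym ∘ h≗g) g↑ , weight-resp h≗g) , h≗g

  PairOfWeight : ∀ {s r} (k : ℕ) → (Fin n → Fin s) × (Fin n → Fin r) → Set
  PairOfWeight k (f , g) = OrderPreserving P f × OrderPreserving P g × weight f + weight g ≡ k

  pairsSplitAt : (s r k i : ℕ) → List ((Fin n → Fin s) × (Fin n → Fin r))
  pairsSplitAt s r k i = cartesianProduct (orderMaps s i) (orderMaps r (k ∸ i))

  pairsOfWeight : (s r k : ℕ) → List ((Fin n → Fin s) × (Fin n → Fin r))
  pairsOfWeight s r k = concatMap (pairsSplitAt s r k) (upTo (suc k))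

  length-pairsOfWeight : ∀ s r k → length (pairsOfWeight s r k) ≡ (Ω P s · Ω P r) k
  length-pairsOfWeight s r k = trans (length-concatMap (pairsSplitAt s r k) (upTo (suc k)))
    (cong sum (map-cong (λ i → length-cartesianProduct (orderMaps s i) (orderMaps r (k ∸ i))) (upTo (suc k))))

  ∈-pairsOfWeight⁻ : ∀ {s r k e} → e ∈ pairsOfWeight s r k → PairOfWeight k e
  ∈-pairsOfWeight⁻ {s} {r} {k} {f , g} e∈ with find (∈-concatMap⁻ (pairsSplitAt s r k) {xs = upTo (suc k)} e∈)
  ... | i , i∈ , e∈i with ∈-cartesianProduct⁻ (orderMaps s i) (orderMaps r (k ∸ i)) e∈i
  ... | f∈ , g∈ with ∈-filter⁻ _ {xs = allMaps n s} f∈ | ∈-filter⁻ _ {xs = allMaps n r} g∈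
  ... | _ , f↑ , refl | _ , g↑ , wg =
    f↑ , g↑ , trans (cong (weight f +_) wg) (m+[n∸m]≡n (s≤s⁻¹ (∈-upTo⁻ i∈)))

  ∈-pairsOfWeight⁺ : ∀ {s r k e} → PairOfWeight {s} {r} k e → ∃[ e' ] e' ∈ pairsOfWeight s r k × e' ≗² e
  ∈-pairsOfWeight⁺ {s} {r} {k} {f , g} (f↑ , g↑ , refl)
    with orderMaps-complete f f↑ | orderMaps-complete g g↑
  ... | f' , f'∈ , f'≗f | g' , g'∈ , g'≗g =
    (f' , g') ,
    ∈-concatMap⁺ (pairsSplitAt s r k) {xs = upTo (suc k)}
      (Any.map (λ { refl → ∈-cartesianProduct⁺ f'∈
                             (subst (λ w → g' ∈ orderMaps r w) (sym (m+n∸m≡n (weight f) (weight g))) g'∈) })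
               (∈-upTo⁺ (s≤s (m≤m+n (weight f) (weight g))))) ,
    f'≗f , g'≗g

  pairsOfWeight-distinct : ∀ s r k →
    Unique ((Fin n →-setoid Fin s) ×ₛ (Fin n →-setoid Fin r)) (pairsOfWeight s r k)
  pairsOfWeight-distinct s r k = AllPairs.concat⁺
    (All.map⁺ (All.universal (λ i → Unique.cartesianProduct⁺ (Fin n →-setoid Fin s) (Fin n →-setoid Fin r)
       (Unique.filter⁺ (Fin n →-setoid Fin s) (isOrderMapOfWeight? i) (allMaps-distinct n s))
       (Unique.filter⁺ (Fin n →-setoid Fin r) (isOrderMapOfWeight? (k ∸ i)) (allMaps-distinct n r))) (upTo (suc k))))
    (AllPairs.map⁺ (AllPairs.map different-splits (AllPairs.applyUpTo⁺₁ (λ i → i) (suc k) (λ i<j _ → <⇒≢ i<j))))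
    where
    weight₁ : ∀ {i e} → e ∈ pairsSplitAt s r k i → weight (proj₁ e) ≡ i
    weight₁ {i} e∈ = proj₂ (proj₂ (∈-filter⁻ _ {xs = allMaps n s}
      (proj₁ (∈-cartesianProduct⁻ (orderMaps s i) (orderMaps r (k ∸ i)) e∈))))
    different-splits : ∀ {i j} → i ≢ j →
      All (λ e → All (λ e' → ¬ e ≗² e') (pairsSplitAt s r k j)) (pairsSplitAt s r k i)
    different-splits {i} {j} i≢j = All.tabulate λ e∈ → All.tabulate λ e'∈ (f≗f' , _) →
      i≢j (trans (sym (weight₁ {i} e∈)) (trans (weight-resp f≗f') (weight₁ {j} e'∈)))

  ≥q-injection : ∀ {s r s' r'}
    (φ : (Fin n → Fin s) × (Fin n → Fin r) → (Fin n → Fin s') × (Fin n → Fin r')) →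
    (∀ {k e} → PairOfWeight k e → PairOfWeight k (φ e)) →
    (∀ {k e e'} → PairOfWeight k e → PairOfWeight k e' → φ e ≗² φ e' → e ≗² e') →
    (Ω P s' · Ω P r') ≥q (Ω P s · Ω P r)
  ≥q-injection {s} {r} {s'} {r'} φ φ-weight φ-injective k = begin
    (Ω P s · Ω P r) k              ≡⟨ length-pairsOfWeight s r k ⟨
    length (pairsOfWeight s r k)   ≤⟨ length-≤-injection ((Fin n →-setoid Fin s) ×ₛ (Fin n →-setoid Fin r))
                                        (λ d e → d ≗² φ e) (pairsOfWeight s r k) (pairsOfWeight s' r' k)
                                        (pairsOfWeight-distinct s r k) cover injective ⟩
    length (pairsOfWeight s' r' k) ≡⟨ length-pairsOfWeight s' r' k ⟩
    (Ω P s' · Ω P r') k            ∎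
    where
    open ≤-Reasoning
    cover : ∀ {e} → e ∈ pairsOfWeight s r k → ∃[ d ] d ∈ pairsOfWeight s' r' k × d ≗² φ e
    cover e∈ = ∈-pairsOfWeight⁺ (φ-weight (∈-pairsOfWeight⁻ e∈))
    injective : ∀ {e e' d} → e ∈ pairsOfWeight s r k → e' ∈ pairsOfWeight s r k →
      d ≗² φ e → d ≗² φ e' → e ≗² e'
    injective e∈ e'∈ (d₁≗ , d₂≗) (d₁≗′ , d₂≗′) =
      φ-injective (∈-pairsOfWeight⁻ e∈) (∈-pairsOfWeight⁻ e'∈)
        ((λ x → trans (sym (d₁≗ x)) (d₁≗′ x)) , (λ x → trans (sym (d₂≗ x)) (d₂≗′ x)))

subsetOf : ∀ {n} {P : Pred (Fin n) 0ℓ} → (∀ x → Dec (P x)) → Subset n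
subsetOf P? = tabulate (does ∘ P?)

∈-subsetOf⁺ : ∀ {n} {P : Pred (Fin n) 0ℓ} (P? : ∀ x → Dec (P x)) {x} → P x → x ∈ₛ subsetOf P?
∈-subsetOf⁺ P? {x} px = lookup⇒[]= x _ (trans (lookup∘tabulate (does ∘ P?) x) (dec-true (P? x) px))

∈-subsetOf⁻ : ∀ {n} {P : Pred (Fin n) 0ℓ} (P? : ∀ x → Dec (P x)) {x} → x ∈ₛ subsetOf P? → P x
∈-subsetOf⁻ P? {x} x∈ with P? x | trans (sym (lookup∘tabulate (does ∘ P?) x)) ([]=⇒lookup x∈)
... | yes px | _  = px
... | no _   | ()

module _ {n : ℕ} (Edge : Rel (Fin n) 0ℓ) (Seed : Pred (Fin n) 0ℓ) where

  record Closed (s : Subset n) : Set where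
    field
      forward  : ∀ {x y} → Edge x y → x ∈ₛ s → y ∈ₛ s
      backward : ∀ {x y} → Edge x y → y ∈ₛ s → x ∈ₛ s
      seeded   : ∀ {x} → Seed x → x ∈ₛ s

  InClosure : Pred (Fin n) 0ℓ
  InClosure x = ∀ s → Closed s → x ∈ₛ s

  closed? : (∀ x y → Dec (Edge x y)) → (∀ x → Dec (Seed x)) → ∀ s → Dec (Closed s)
  closed? edge? seed? s = map′
    (λ (f , b , c) → record { forward = λ {x} {y} → f x y ; backward = λ {x} {y} → b x y ; seeded = λ {x} → c x })
    (λ c → (λ x y → Closed.forward c) , (λ x y → Closed.backward c) , (λ x → Closed.seeded c))
    (all? (λ x → all? λ y → edge? x y →-dec (x ∈? s →-dec y ∈? s)) ×-dec
     all? (λ x → all? λ y → edge? x y →-dec (y ∈? s →-dec x ∈? s)) ×-dec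
     all? (λ x → seed? x →-dec x ∈? s))

  -- Opaque, so that conversion checking never unfolds the search through all subsets.
  opaque
    inClosure? : (∀ x y → Dec (Edge x y)) → (∀ x → Dec (Seed x)) → ∀ x → Dec (InClosure x)
    inClosure? edge? seed? x with anySubset? (λ s → closed? edge? seed? s ×-dec ¬? (x ∈? s))
    ... | yes (s , closed , x∉s) = no λ x∈closure → x∉s (x∈closure s closed)
    ... | no ∄s = yes λ s closed → decidable-stable (x ∈? s) λ x∉s → ∄s (s , closed , x∉s)

module _ {n : ℕ} {Edge : Rel (Fin n) 0ℓ} {Seed : Pred (Fin n) 0ℓ} where

  closure-least : {P : Pred (Fin n) 0ℓ} (P? : ∀ x → Dec (P x)) →
    (∀ {x y} → Edge x y → P x → P y) → (∀ {x y} → Edge x y → P y → P x) → (∀ {x} → Seed x → P x) →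
    ∀ {x} → InClosure Edge Seed x → P x
  closure-least P? forward backward seeded x∈ = ∈-subsetOf⁻ P? (x∈ (subsetOf P?) record
    { forward  = λ edge → ∈-subsetOf⁺ P? ∘ forward edge ∘ ∈-subsetOf⁻ P?
    ; backward = λ edge → ∈-subsetOf⁺ P? ∘ backward edge ∘ ∈-subsetOf⁻ P?
    ; seeded   = ∈-subsetOf⁺ P? ∘ seeded
    })

  closure-seed : ∀ {x} → Seed x → InClosure Edge Seed x
  closure-seed seed s closed = Closed.seeded closed seed

  closure-forward : ∀ {x y} → Edge x y → InClosure Edge Seed x → InClosure Edge Seed y
  closure-forward edge x∈ s closed = Closed.forward closed edge (x∈ s closed)

  closure-backward : ∀ {x y} → Edge x y → InClosure Edge Seed y → InClosure Edge Seed x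
  closure-backward edge y∈ s closed = Closed.backward closed edge (y∈ s closed)

closure-mono : ∀ {n} {Edge Edge' : Rel (Fin n) 0ℓ} {Seed Seed' : Pred (Fin n) 0ℓ} →
  (∀ {x y} → Edge' x y → Edge x y) → (∀ {x} → Seed' x → Seed x) →
  ∀ {x} → InClosure Edge' Seed' x → InClosure Edge Seed x
closure-mono edge⊆ seed⊆ x∈ s closed = x∈ s record
  { forward  = Closed.forward closed ∘ edge⊆
  ; backward = Closed.backward closed ∘ edge⊆
  ; seeded   = Closed.seeded closed ∘ seed⊆
  }

swapOn : ∀ {n} {S : Pred (Fin n) 0ℓ} → (∀ x → Dec (S x)) → (Fin n → ℕ) → (Fin n → ℕ) → Fin n → ℕ
swapOn S? U V x = if does (S? x) then V x else U x

module _ {n} {S : Pred (Fin n) 0ℓ} (S? : ∀ x → Dec (S x)) (U V : Fin n → ℕ) where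

  swapOn-+ : ∀ x → swapOn S? U V x + swapOn S? V U x ≡ U x + V x
  swapOn-+ x with S? x
  ... | yes _ = +-comm (V x) (U x)
  ... | no _  = refl

  swapOn-swapOn : swapOn S? (swapOn S? U V) (swapOn S? V U) ≗ U
  swapOn-swapOn x with S? x
  ... | yes _ = refl
  ... | no _  = refl

swapOn-cong : ∀ {n} {S S' : Pred (Fin n) 0ℓ} (S? : ∀ x → Dec (S x)) (S'? : ∀ x → Dec (S' x)) →
  (∀ {x} → S x → S' x) → (∀ {x} → S' x → S x) →
  ∀ {U U' V V' : Fin n → ℕ} → U ≗ U' → V ≗ V' → swapOn S? U V ≗ swapOn S'? U' V'
swapOn-cong S? S'? S⊆S' S'⊆S U≗U' V≗V' x with S? x | S'? x
... | yes _  | yes _   = V≗V' x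
... | no _   | no _    = U≗U' x
... | yes sx | no ¬s'x = contradiction (S⊆S' sx) ¬s'x
... | no ¬sx | yes s'x = contradiction (S'⊆S s'x) ¬sx

module _ {n} (P : FinPoset n) where
  open FinPoset P

  Monotone : (Fin n → ℕ) → Set
  Monotone U = ∀ x y → x ≺ y → U x ≤ U y

  Crossing : (U V : Fin n → ℕ) → Rel (Fin n) 0ℓ
  Crossing U V x y = x ≺ y × (U y < V x ⊎ V y < U x)

  crossing? : ∀ U V x y → Dec (Crossing U V x y)
  crossing? U V x y = (x ≺? y) ×-dec (U y <? V x ⊎-dec V y <? U x)

  crossing-sym : ∀ {U V x y} → Crossing U V x y → Crossing V U x y
  crossing-sym (x≺y , inj₁ lt) = x≺y , inj₂ lt
  crossing-sym (x≺y , inj₂ lt) = x≺y , inj₁ lt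

  crossing-cong : ∀ {U U' V V' x y} → U ≗ U' → V ≗ V' → Crossing U V x y → Crossing U' V' x y
  crossing-cong {x = x} {y} U≗U' V≗V' (x≺y , inj₁ lt) = x≺y , inj₁ (subst₂ _<_ (U≗U' y) (V≗V' x) lt)
  crossing-cong {x = x} {y} U≗U' V≗V' (x≺y , inj₂ lt) = x≺y , inj₂ (subst₂ _<_ (V≗V' y) (U≗U' x) lt)

  module _ {S : Pred (Fin n) 0ℓ} (S? : ∀ x → Dec (S x)) (U V : Fin n → ℕ) where

    swapOn-monotone : Monotone U → Monotone V →
      (∀ {x y} → Crossing U V x y → S x → S y) → (∀ {x y} → Crossing U V x y → S y → S x) →
      Monotone (swapOn S? U V)
    swapOn-monotone U↑ V↑ forward backward x y x≺y with S? x | S? y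
    ... | yes _  | yes _  = V↑ x y x≺y
    ... | no _   | no _   = U↑ x y x≺y
    ... | yes sx | no ¬sy = ≮⇒≥ λ Uy<Vx → ¬sy (forward (x≺y , inj₁ Uy<Vx) sx)
    ... | no ¬sx | yes sy = ≮⇒≥ λ Vy<Ux → ¬sx (backward (x≺y , inj₂ Vy<Ux) sy)

    crossing-swapOn⁺ : (∀ {x y} → Crossing U V x y → S x → S y) → (∀ {x y} → Crossing U V x y → S y → S x) →
      ∀ {x y} → Crossing U V x y → Crossing (swapOn S? U V) (swapOn S? V U) x y
    crossing-swapOn⁺ forward backward {x} {y} c with S? x | S? y
    ... | yes _  | yes _  = crossing-sym c
    ... | no _   | no _   = c
    ... | yes sx | no ¬sy = contradiction (forward c sx) ¬sy
    ... | no ¬sx | yes sy = contradiction (backward c sy) ¬sx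

    crossing-swapOn⁻ : Monotone U → Monotone V →
      ∀ {x y} → Crossing (swapOn S? U V) (swapOn S? V U) x y → Crossing U V x y
    crossing-swapOn⁻ U↑ V↑ {x} {y} c with S? x | S? y | c
    ... | yes _ | yes _ | c′ = crossing-sym c′
    ... | no _  | no _  | c′ = c′
    ... | yes _ | no _  | x≺y , inj₁ Uy<Ux = contradiction (U↑ x y x≺y) (<⇒≱ Uy<Ux)
    ... | yes _ | no _  | x≺y , inj₂ Vy<Vx = contradiction (V↑ x y x≺y) (<⇒≱ Vy<Vx)
    ... | no _  | yes _ | x≺y , inj₁ Vy<Vx = contradiction (V↑ x y x≺y) (<⇒≱ Vy<Vx)
    ... | no _  | yes _ | x≺y , inj₂ Uy<Ux = contradiction (U↑ x y x≺y) (<⇒≱ Uy<Ux)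

  module _ {U V : Fin n → ℕ} (U↑ : Monotone U) (V↑ : Monotone V) where

    dominance-forward : ∀ {x y} → Crossing U V x y → V x < U x → V y < U y
    dominance-forward {x} {y} (x≺y , inj₁ Uy<Vx) Vx<Ux = contradiction (<-trans Uy<Vx Vx<Ux) (≤⇒≯ (U↑ x y x≺y))
    dominance-forward {x} {y} (x≺y , inj₂ Vy<Ux) _     = <-≤-trans Vy<Ux (U↑ x y x≺y)

    dominance-backward : ∀ {x y} → Crossing U V x y → V y < U y → V x < U x
    dominance-backward {x} {y} (x≺y , inj₁ Uy<Vx) Vy<Uy = contradiction (≤-<-trans (V↑ x y x≺y) Vy<Uy) (<-asym Uy<Vx)
    dominance-backward {x} {y} (x≺y , inj₂ Vy<Ux) _     = ≤-<-trans (V↑ x y x≺y) Vy<Ux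

  module _ (T : ℕ) where

    -- Symmetric in U and V (although only U reaches T in the application), so that the
    -- exchanged pair has the same seeds.
    Saturated : (U V : Fin n → ℕ) → Pred (Fin n) 0ℓ
    Saturated U V x = U x ≡ T ⊎ V x ≡ T

    SwapSet : (U V : Fin n → ℕ) → Pred (Fin n) 0ℓ
    SwapSet U V = InClosure (Crossing U V) (Saturated U V)

    swapSet? : ∀ U V x → Dec (SwapSet U V x)
    swapSet? U V = inClosure? _ _ (crossing? U V) (λ x → U x ≟ T ⊎-dec V x ≟ T)

    exchange : (Fin n → ℕ) × (Fin n → ℕ) → (Fin n → ℕ) × (Fin n → ℕ)
    exchange (U , V) = swapOn (swapSet? U V) U V , swapOn (swapSet? U V) V U

    saturated-cong : ∀ {U U' V V' x} → U ≗ U' → V ≗ V' → Saturated U V x → Saturated U' V' x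
    saturated-cong {x = x} U≗U' V≗V' (inj₁ Ux≡T) = inj₁ (trans (sym (U≗U' x)) Ux≡T)
    saturated-cong {x = x} U≗U' V≗V' (inj₂ Vx≡T) = inj₂ (trans (sym (V≗V' x)) Vx≡T)

    saturated-swapOn⁺ : ∀ {S : Pred (Fin n) 0ℓ} (S? : ∀ x → Dec (S x)) U V {x} →
      Saturated U V x → Saturated (swapOn S? U V) (swapOn S? V U) x
    saturated-swapOn⁺ S? U V {x} sat with S? x | sat
    ... | yes _ | inj₁ Ux≡T = inj₂ Ux≡T
    ... | yes _ | inj₂ Vx≡T = inj₁ Vx≡T
    ... | no _  | sat′      = sat′

    saturated-swapOn⁻ : ∀ {S : Pred (Fin n) 0ℓ} (S? : ∀ x → Dec (S x)) U V {x} →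
      Saturated (swapOn S? U V) (swapOn S? V U) x → Saturated U V x
    saturated-swapOn⁻ S? U V {x} sat with S? x | sat
    ... | yes _ | inj₁ Vx≡T = inj₂ Vx≡T
    ... | yes _ | inj₂ Ux≡T = inj₁ Ux≡T
    ... | no _  | sat′      = sat′

    swapSet-cong : ∀ {U U' V V' x} → U ≗ U' → V ≗ V' → SwapSet U V x → SwapSet U' V' x
    swapSet-cong U≗U' V≗V' = closure-mono (crossing-cong U≗U' V≗V') (saturated-cong U≗U' V≗V')

    exchange-cong : ∀ {U U' V V'} → U ≗ U' → V ≗ V' → exchange (U , V) ≗² exchange (U' , V')
    exchange-cong {U} {U'} {V} {V'} U≗U' V≗V' = swap U≗U' V≗V' , swap V≗V' U≗U'
      where
      swap : ∀ {W W' X X'} → W ≗ W' → X ≗ X' → swapOn (swapSet? U V) W X ≗ swapOn (swapSet? U' V') W' X'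
      swap = swapOn-cong (swapSet? U V) (swapSet? U' V')
        (swapSet-cong U≗U' V≗V') (swapSet-cong (sym ∘ U≗U') (sym ∘ V≗V'))

    exchange-+ : ∀ U V x → proj₁ (exchange (U , V)) x + proj₂ (exchange (U , V)) x ≡ U x + V x
    exchange-+ U V = swapOn-+ (swapSet? U V) U V

    module _ {U V : Fin n → ℕ} (U↑ : Monotone U) (V↑ : Monotone V) where

      private
        S? = swapSet? U V
        A  = swapOn S? U V
        B  = swapOn S? V U

      exchange-monotone : Monotone A × Monotone B
      exchange-monotone =
        swapOn-monotone S? U V U↑ V↑ closure-forward closure-backward ,
        swapOn-monotone S? V U V↑ U↑ (closure-forward ∘ crossing-sym) (closure-backward ∘ crossing-sym)

      swapSet-exchange⁺ : ∀ {x} → SwapSet U V x → SwapSet A B x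
      swapSet-exchange⁺ =
        closure-mono (crossing-swapOn⁺ S? U V closure-forward closure-backward) (saturated-swapOn⁺ S? U V)

      swapSet-exchange⁻ : ∀ {x} → SwapSet A B x → SwapSet U V x
      swapSet-exchange⁻ = closure-mono (crossing-swapOn⁻ S? U V U↑ V↑) (saturated-swapOn⁻ S? U V)

      exchange-involutive : exchange (A , B) ≗² (U , V)
      exchange-involutive = swapping-back U V , swapping-back V U
        where
        swapping-back : ∀ W W' → swapOn (swapSet? A B) (swapOn S? W W') (swapOn S? W' W) ≗ W
        swapping-back W W' x = trans
          (swapOn-cong (swapSet? A B) S? swapSet-exchange⁻ swapSet-exchange⁺
                       {U = swapOn S? W W'} {V = swapOn S? W' W} (λ _ → refl) (λ _ → refl) x)
          (swapOn-swapOn S? W W' x)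

      swapSet-dominated : (∀ x → V x < T) → ∀ {x} → SwapSet U V x → V x < U x
      swapSet-dominated V<T =
        closure-least (λ x → V x <? U x) (dominance-forward U↑ V↑) (dominance-backward U↑ V↑) seed
        where
        seed : ∀ {x} → Saturated U V x → V x < U x
        seed {x} (inj₁ Ux≡T) = subst (V x <_) (sym Ux≡T) (V<T x)
        seed {x} (inj₂ Vx≡T) = contradiction Vx≡T (<⇒≢ (V<T x))

module Encoding {n : ℕ} (P : FinPoset n) (m : ℕ) where

  lift : (Fin n → Fin (suc m + 1)) × (Fin n → Fin m) → (Fin n → ℕ) × (Fin n → ℕ)
  lift (f , g) = toℕ ∘ f , suc ∘ toℕ ∘ g

  -- Reducing mod (suc m) only makes encode total: on order-preserving pairs nothing is reduced.
  encode : (Fin n → Fin (suc m + 1)) × (Fin n → Fin m) → (Fin n → Fin (suc m)) × (Fin n → Fin (suc m))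
  encode p = let (A , B) = exchange P (suc m) (lift p) in
    (λ x → A x mod suc m) , (λ x → (B x ∸ 1) mod suc m)

  suc-monotone : ∀ {g : Fin n → Fin m} → OrderPreserving P g → Monotone P (suc ∘ toℕ ∘ g)
  suc-monotone g↑ x y x≺y = s≤s (g↑ x y x≺y)

  module _ {f : Fin n → Fin (suc m + 1)} {g : Fin n → Fin m} (f↑ : OrderPreserving P f) (g↑ : OrderPreserving P g) where

    private
      U V A B : Fin n → ℕ
      U = proj₁ (lift (f , g))
      V = proj₂ (lift (f , g))
      A = proj₁ (exchange P (suc m) (U , V))
      B = proj₂ (exchange P (suc m) (U , V))

      V↑ : Monotone P V
      V↑ = suc-monotone g↑

      U≤t : ∀ x → U x ≤ suc m
      U≤t x = ≤-trans (toℕ≤pred[n] (f x)) (≤-reflexive (+-comm m 1))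

      V≤m : ∀ x → V x ≤ m
      V≤m x = toℕ<n (g x)

    A<t : ∀ x → A x < suc m
    A<t x with swapSet? P (suc m) U V x
    ... | yes _    = s≤s (V≤m x)
    ... | no ∉swap = ≤∧≢⇒< (U≤t x) λ Ux≡t → ∉swap (closure-seed (inj₁ Ux≡t))

    1≤B : ∀ x → 1 ≤ B x
    1≤B x with swapSet? P (suc m) U V x
    ... | yes ∈swap = ≤-trans (s≤s z≤n) (swapSet-dominated P (suc m) f↑ V↑ (s≤s ∘ V≤m) ∈swap)
    ... | no _      = s≤s z≤n

    B≤t : ∀ x → B x ≤ suc m
    B≤t x with swapSet? P (suc m) U V x
    ... | yes _ = U≤t x
    ... | no _  = m≤n⇒m≤1+n (V≤m x)

    toℕ-encode₁ : ∀ x → toℕ (proj₁ (encode (f , g)) x) ≡ A x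
    toℕ-encode₁ x = toℕ-mod (A<t x)

    toℕ-encode₂ : ∀ x → toℕ (proj₂ (encode (f , g)) x) ≡ B x ∸ 1
    toℕ-encode₂ x = toℕ-mod (s≤s (∸-monoˡ-≤ 1 (B≤t x)))

    encode-orderPreserving :
      OrderPreserving P (proj₁ (encode (f , g))) × OrderPreserving P (proj₂ (encode (f , g)))
    encode-orderPreserving =
      (λ x y x≺y → subst₂ _≤_ (sym (toℕ-encode₁ x)) (sym (toℕ-encode₁ y)) (A↑ x y x≺y)) ,
      (λ x y x≺y → subst₂ _≤_ (sym (toℕ-encode₂ x)) (sym (toℕ-encode₂ y)) (∸-monoˡ-≤ 1 (B↑ x y x≺y)))
      where
      A↑ : Monotone P A
      A↑ = proj₁ (exchange-monotone P (suc m) f↑ V↑)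
      B↑ : Monotone P B
      B↑ = proj₂ (exchange-monotone P (suc m) f↑ V↑)

    encode-weight :
      weight (proj₁ (encode (f , g))) + weight (proj₂ (encode (f , g))) ≡ weight f + weight g
    encode-weight = weight-+-cong λ x → begin
      toℕ (proj₁ (encode (f , g)) x) + toℕ (proj₂ (encode (f , g)) x) ≡⟨ cong₂ _+_ (toℕ-encode₁ x) (toℕ-encode₂ x) ⟩
      A x + (B x ∸ 1)                                                 ≡⟨ +-∸-assoc (A x) (1≤B x) ⟨
      A x + B x ∸ 1                                                   ≡⟨ cong (_∸ 1) (exchange-+ P (suc m) U V x) ⟩
      U x + suc (toℕ (g x)) ∸ 1                                       ≡⟨ cong (_∸ 1) (+-suc (U x) (toℕ (g x))) ⟩
      toℕ (f x) + toℕ (g x)                                           ∎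
      where open ≡-Reasoning

  encode-pairOfWeight : ∀ {k p} → PairOfWeight P k p → PairOfWeight P k (encode p)
  encode-pairOfWeight (f↑ , g↑ , w) =
    proj₁ (encode-orderPreserving f↑ g↑) , proj₂ (encode-orderPreserving f↑ g↑) , trans (encode-weight f↑ g↑) w

  encode-injective : ∀ {p p'} → OrderPreserving P (proj₁ p) → OrderPreserving P (proj₂ p) →
    OrderPreserving P (proj₁ p') → OrderPreserving P (proj₂ p') → encode p ≗² encode p' → p ≗² p'
  encode-injective {f , g} {f' , g'} f↑ g↑ f'↑ g'↑ (e₁ , e₂) =
    (λ x → toℕ-injective (proj₁ same-lift x)) , (λ x → toℕ-injective (suc-injective (proj₂ same-lift x)))
    where
    same-A : proj₁ (exchange P (suc m) (lift (f , g))) ≗ proj₁ (exchange P (suc m) (lift (f' , g')))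
    same-A x = trans (sym (toℕ-encode₁ f↑ g↑ x)) (trans (cong toℕ (e₁ x)) (toℕ-encode₁ f'↑ g'↑ x))
    same-B : proj₂ (exchange P (suc m) (lift (f , g))) ≗ proj₂ (exchange P (suc m) (lift (f' , g')))
    same-B x = ∸-cancelʳ-≡ (1≤B f↑ g↑ x) (1≤B f'↑ g'↑ x)
      (trans (sym (toℕ-encode₂ f↑ g↑ x)) (trans (cong toℕ (e₂ x)) (toℕ-encode₂ f'↑ g'↑ x)))
    open import Relation.Binary.Reasoning.Setoid ((Fin n →-setoid ℕ) ×ₛ (Fin n →-setoid ℕ))
    same-lift : lift (f , g) ≗² lift (f' , g')
    same-lift = begin
      lift (f , g)                                             ≈⟨ exchange-involutive P (suc m) f↑ (suc-monotone g↑) ⟨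
      exchange P (suc m) (exchange P (suc m) (lift (f , g)))   ≈⟨ exchange-cong P (suc m) same-A same-B ⟩
      exchange P (suc m) (exchange P (suc m) (lift (f' , g'))) ≈⟨ exchange-involutive P (suc m) f'↑ (suc-monotone g'↑) ⟩
      lift (f' , g')                                           ∎

Ω-log-concave : ∀ {n} (P : FinPoset n) m → (Ω P (suc m) · Ω P (suc m)) ≥q (Ω P (suc m + 1) · Ω P m)
Ω-log-concave P m = ≥q-injection P encode encode-pairOfWeight
  λ (f↑ , g↑ , _) (f'↑ , g'↑ , _) → encode-injective f↑ g↑ f'↑ g'↑
  where open Encoding P m

corollary5p9 : ∀ {n} (P : FinPoset n) (t : ℕ) → 2 ≤ t →
    (Ω P t · Ω P t) ≥q (Ω P (t + 1) · Ω P (t ∸ 1))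
corollary5p9 P (suc m) _ = Ω-log-concave P m
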